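{- Let $G$ be a simple graph with edges $e_1,\dots,e_m$ and let $H_1,\dots,H_m$ be simple graphs. Then the chromatic number of the generalized edge corona product satisfies $$\chi(G\diamond(H_1,\dots,H_m))=\max_{1\le i\le m}\{\chi(G),\ \chi(H_i)+2\}.$$
   Context: For a simple graph $G$ with edge set $\{e_1,\dots,e_m\}$ and simple graphs $H_1,\dots,H_m$, the generalized edge corona product $G\diamond(H_1,\dots,H_m)$ is the graph obtained by taking one (vertex-disjoint) copy of each of $G,H_1,\dots,H_m$ and joining both end vertices of the $i$-th edge $e_i$ of $G$ to every vertex of $H_i$, for $1\le i\le m$. $\chi$ denotes the (proper vertex) chromatic number. -}

module Defs where

open import Data.Nat using (ℕ; zero; suc; _+_; _≤_; _⊔_)
open import Data.Fin using (Fin)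
import Data.Fin as F
open import Data.Product using (Σ; _,_; _×_; proj₁; proj₂)
open import Data.Sum using (_⊎_; inj₁; inj₂)
open import Relation.Nullary using (¬_)
open import Relation.Binary.PropositionalEquality using (_≡_; _≢_; refl)

record SimpleGraph (V : Set) : Set₁ where
  field
    Adj    : V → V → Set
    sym    : ∀ {u v} → Adj u v → Adj v u
    irrefl : ∀ {v} → ¬ Adj v v
open SimpleGraph public

ProperColoring : ∀ {V} → SimpleGraph V → ℕ → Set
ProperColoring {V} G k =
  Σ (V → Fin k) λ c → ∀ {u v} → Adj G u v → c u ≢ c v

IsChromaticNumber : ∀ {V} → SimpleGraph V → ℕ → Set
IsChromaticNumber G k =
  ProperColoring G k × (∀ j → ProperColoring G j → k ≤ j)

-- The map e : Fin m → Fin n × Fin n is an enumeration e_1,…,e_m of the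
-- edge set of G (each edge listed exactly once, as an ordered pair of ends).
SameEdge : ∀ {n} → Fin n × Fin n → Fin n × Fin n → Set
SameEdge (a , b) (c , d) = (a ≡ c × b ≡ d) ⊎ (a ≡ d × b ≡ c)

IsEdgeEnumeration : ∀ {n} → SimpleGraph (Fin n) → (m : ℕ) →
                    (Fin m → Fin n × Fin n) → Set
IsEdgeEnumeration {n} G m e =
  (∀ i → Adj G (proj₁ (e i)) (proj₂ (e i)))
  × (∀ u v → Adj G u v → Σ (Fin m) λ i → SameEdge (e i) (u , v))
  × (∀ i j → SameEdge (e i) (e j) → i ≡ j)

CoronaV : (n m : ℕ) (h : Fin m → ℕ) → Set
CoronaV n m h = Fin n ⊎ Σ (Fin m) (λ i → Fin (h i))

module _ {n m : ℕ} (G : SimpleGraph (Fin n)) (e : Fin m → Fin n × Fin n)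
         {h : Fin m → ℕ} (H : (i : Fin m) → SimpleGraph (Fin (h i))) where

  EndOf : Fin m → Fin n → Set
  EndOf i u = (u ≡ proj₁ (e i)) ⊎ (u ≡ proj₂ (e i))

  data CoronaAdj : CoronaV n m h → CoronaV n m h → Set where
    gg : ∀ {u v} → Adj G u v → CoronaAdj (inj₁ u) (inj₁ v)
    hh : ∀ i {x y} → Adj (H i) x y → CoronaAdj (inj₂ (i , x)) (inj₂ (i , y))
    gh : ∀ i {u} x → EndOf i u → CoronaAdj (inj₁ u) (inj₂ (i , x))
    hg : ∀ i {u} x → EndOf i u → CoronaAdj (inj₂ (i , x)) (inj₁ u)

  private
    csym : ∀ {a b} → CoronaAdj a b → CoronaAdj b a
    csym (gg p) = gg (sym G p)
    csym (hh i p) = hh i (sym (H i) p)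
    csym (gh i x p) = hg i x p
    csym (hg i x p) = gh i x p

    cirr : ∀ {a} → ¬ CoronaAdj a a
    cirr (gg p) = irrefl G p
    cirr (hh i p) = irrefl (H i) p

  EdgeCorona : SimpleGraph (CoronaV n m h)
  EdgeCorona = record { Adj = CoronaAdj ; sym = csym ; irrefl = cirr }

maxFin : ∀ {m} → (Fin m → ℕ) → ℕ
maxFin {zero}  f = 0
maxFin {suc m} f = f F.zero ⊔ maxFin (λ i → f (F.suc i))

module Submission where

-- Lower bound.  G is a subgraph of the corona, so χ(G) colours are
-- needed.  Each copy of Hᵢ lies inside the double cone over the edge eᵢ = uv:
-- every vertex of Hᵢ is adjacent to both u and v, which are adjacent to each
-- other.  Hence a proper j-colouring restricted to Hᵢ avoids the two distinct
-- colours of u and v, and squeezing those two colours out of Fin j yields a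
-- proper colouring of Hᵢ with j - 2 colours; so χ(Hᵢ) + 2 ≤ j.
--
-- Upper bound.  With k = max(…) colours, colour G by an optimal colouring
-- (weakened to k colours), and colour each Hᵢ by an optimal colouring spread
-- injectively into the k - 2 colours different from those of the ends of eᵢ.

open import Defs hiding (sym)
open import Data.Nat using (ℕ; zero; suc; _+_; _⊔_; _≤_; s≤s; z≤n)
open import Data.Nat.Properties using (+-comm; ≤-trans; m≤m⊔n; m≤n⊔m; ⊔-lub)
open import Data.Fin using (Fin; punchIn; punchOut; inject≤)
import Data.Fin as F
open import Data.Fin.Properties
  using (punchIn-injective; punchInᵢ≢i; punchOut-injective; punchIn-punchOut; inject≤-injective)
open import Data.Product using (Σ; _×_; _,_; proj₁; proj₂)
open import Data.Sum using (inj₁; inj₂)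
open import Data.Empty using (⊥-elim)
open import Relation.Binary.PropositionalEquality using (_≡_; _≢_; refl; sym; trans; subst)

record Hom {V W} (K : SimpleGraph V) (L : SimpleGraph W) : Set where
  field
    map      : V → W
    preserve : ∀ {u v} → Adj K u v → Adj L (map u) (map v)
open Hom

pullback : ∀ {V W} {K : SimpleGraph V} {L : SimpleGraph W} {j} →
           Hom K L → ProperColoring L j → ProperColoring K j
pullback f (c , proper) = (λ x → c (map f x)) , (λ adj → proper (preserve f adj))

chromatic-hom-bound : ∀ {V W} {K : SimpleGraph V} {L : SimpleGraph W} {χ j} →
                      Hom K L → IsChromaticNumber K χ → ProperColoring L j → χ ≤ j
chromatic-hom-bound {j = j} f (_ , minimal) c = minimal j (pullback f c)

weaken : ∀ {V} (K : SimpleGraph V) {k l} → k ≤ l → ProperColoring K k → ProperColoring K l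
weaken K k≤l (c , proper) =
  (λ x → inject≤ (c x) k≤l) , (λ adj eq → proper adj (inject≤-injective k≤l k≤l _ _ eq))

-- Reserving two distinct colours a, b of Fin k, k ≥ p + 2: an injection of
-- Fin p into the remaining colours.
spread : ∀ {p k} → suc (suc p) ≤ k → (a b : Fin k) → a ≢ b → Fin p → Fin k
spread {k = suc (suc _)} (s≤s (s≤s p≤r)) a b a≢b x =
  punchIn a (punchIn (punchOut a≢b) (inject≤ x p≤r))

spread-avoids-a : ∀ {p k} (p+2≤k : suc (suc p) ≤ k) a b (a≢b : a ≢ b) x →
                  spread p+2≤k a b a≢b x ≢ a
spread-avoids-a {k = suc (suc _)} (s≤s (s≤s _)) a b a≢b x = punchInᵢ≢i a _

spread-avoids-b : ∀ {p k} (p+2≤k : suc (suc p) ≤ k) a b (a≢b : a ≢ b) x →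
                  spread p+2≤k a b a≢b x ≢ b
spread-avoids-b {k = suc (suc _)} (s≤s (s≤s p≤r)) a b a≢b x eq =
  punchInᵢ≢i (punchOut a≢b) (inject≤ x p≤r)
    (punchIn-injective a _ _ (trans eq (sym (punchIn-punchOut a≢b))))

spread-injective : ∀ {p k} (p+2≤k : suc (suc p) ≤ k) a b (a≢b : a ≢ b) x y →
                   spread p+2≤k a b a≢b x ≡ spread p+2≤k a b a≢b y → x ≡ y
spread-injective {k = suc (suc _)} (s≤s (s≤s p≤r)) a b a≢b x y eq =
  inject≤-injective p≤r p≤r x y (punchIn-injective _ _ _ (punchIn-injective a _ _ eq))

-- Conversely, the colours of Fin (r + 2) other than two distinct a, b embed
-- injectively into Fin r.
squeeze : ∀ {r} {a b : Fin (suc (suc r))} → a ≢ b →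
          (x : Fin (suc (suc r))) → a ≢ x → b ≢ x → Fin r
squeeze a≢b x a≢x b≢x =
  punchOut {i = punchOut a≢b} {j = punchOut a≢x} (λ eq → b≢x (punchOut-injective a≢b a≢x eq))

squeeze-injective : ∀ {r} {a b : Fin (suc (suc r))} (a≢b : a ≢ b) {x y}
                    (a≢x : a ≢ x) (b≢x : b ≢ x) (a≢y : a ≢ y) (b≢y : b ≢ y) →
                    squeeze a≢b x a≢x b≢x ≡ squeeze a≢b y a≢y b≢y → x ≡ y
squeeze-injective a≢b a≢x b≢x a≢y b≢y eq =
  punchOut-injective a≢x a≢y
    (punchOut-injective (λ eq′ → b≢x (punchOut-injective a≢b a≢x eq′))
                        (λ eq′ → b≢y (punchOut-injective a≢b a≢y eq′)) eq)

missing-two-colours-bound : ∀ {V} (K : SimpleGraph V) {χ j} → IsChromaticNumber K χ →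
                            (d : V → Fin j) → (∀ {x y} → Adj K x y → d x ≢ d y) →
                            (a b : Fin j) → a ≢ b → (∀ x → a ≢ d x) → (∀ x → b ≢ d x) →
                            χ + 2 ≤ j
missing-two-colours-bound K {j = zero} χK d proper () b a≢b a-free b-free
missing-two-colours-bound K {j = suc zero} χK d proper F.zero F.zero a≢b a-free b-free =
  ⊥-elim (a≢b refl)
missing-two-colours-bound K {χ} {suc (suc r)} (_ , minimal) d proper a b a≢b a-free b-free =
  subst (_≤ suc (suc r)) (+-comm 2 χ) (s≤s (s≤s (minimal r (c , c-proper))))
  where
    c : _ → Fin r
    c x = squeeze a≢b (d x) (a-free x) (b-free x)
    c-proper : ∀ {x y} → Adj K x y → c x ≢ c y
    c-proper {x} {y} adj eq =
      proper adj (squeeze-injective a≢b (a-free x) (b-free x) (a-free y) (b-free y) eq)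

double-cone-bound : ∀ {V W} {K : SimpleGraph V} {L : SimpleGraph W} {χ j} →
                    (f : Hom K L) → IsChromaticNumber K χ → (u v : W) → Adj L u v →
                    (∀ x → Adj L u (map f x)) → (∀ x → Adj L v (map f x)) →
                    ProperColoring L j → χ + 2 ≤ j
double-cone-bound {K = K} f χK u v uv u-cone v-cone (c , proper) =
  missing-two-colours-bound K χK (λ x → c (map f x)) (λ adj → proper (preserve f adj))
    (c u) (c v) (proper uv) (λ x → proper (u-cone x)) (λ x → proper (v-cone x))

maxFin-upper : ∀ {m} (f : Fin m → ℕ) i → f i ≤ maxFin f
maxFin-upper {suc m} f F.zero = m≤m⊔n _ _
maxFin-upper {suc m} f (F.suc i) = ≤-trans (maxFin-upper (λ j → f (F.suc j)) i) (m≤n⊔m _ _)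

maxFin-least : ∀ {m} (f : Fin m → ℕ) j → (∀ i → f i ≤ j) → maxFin f ≤ j
maxFin-least {zero} f j bounded = z≤n
maxFin-least {suc m} f j bounded =
  ⊔-lub (bounded F.zero) (maxFin-least (λ i → f (F.suc i)) j (λ i → bounded (F.suc i)))

module Corona {n m : ℕ} (G : SimpleGraph (Fin n)) (e : Fin m → Fin n × Fin n)
              (edges : ∀ i → Adj G (proj₁ (e i)) (proj₂ (e i)))
              {h : Fin m → ℕ} (H : (i : Fin m) → SimpleGraph (Fin (h i))) where

  G-in-corona : Hom G (EdgeCorona G e H)
  G-in-corona = record { map = inj₁ ; preserve = gg }

  H-in-corona : ∀ i → Hom (H i) (EdgeCorona G e H)
  H-in-corona i = record { map = λ x → inj₂ (i , x) ; preserve = hh i }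

  H-bound : ∀ i {χ j} → IsChromaticNumber (H i) χ →
            ProperColoring (EdgeCorona G e H) j → χ + 2 ≤ j
  H-bound i χHᵢ =
    double-cone-bound (H-in-corona i) χHᵢ (inj₁ (proj₁ (e i))) (inj₁ (proj₂ (e i)))
      (gg (edges i)) (λ x → gh i x (inj₁ refl)) (λ x → gh i x (inj₂ refl))

  corona-coloring : ∀ {k} → ProperColoring G k →
                    (p : Fin m → ℕ) → (∀ i → p i + 2 ≤ k) →
                    (∀ i → ProperColoring (H i) (p i)) →
                    ProperColoring (EdgeCorona G e H) k
  corona-coloring {k} (cG , G-proper) p room cH = c , c-proper
    where
      bound : ∀ i → suc (suc (p i)) ≤ k
      bound i = subst (_≤ k) (+-comm (p i) 2) (room i)

      ends-differ : ∀ i → cG (proj₁ (e i)) ≢ cG (proj₂ (e i))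
      ends-differ i = G-proper (edges i)

      spreadᵢ : ∀ i → Fin (p i) → Fin k
      spreadᵢ i = spread (bound i) (cG (proj₁ (e i))) (cG (proj₂ (e i))) (ends-differ i)

      c : CoronaV n m h → Fin k
      c (inj₁ u) = cG u
      c (inj₂ (i , x)) = spreadᵢ i (proj₁ (cH i) x)

      c-proper : ∀ {u v} → CoronaAdj G e H u v → c u ≢ c v
      c-proper (gg adj) = G-proper adj
      c-proper (hh i adj) eq =
        proj₂ (cH i) adj (spread-injective (bound i) _ _ (ends-differ i) _ _ eq)
      c-proper (gh i x (inj₁ refl)) eq = spread-avoids-a (bound i) _ _ (ends-differ i) _ (sym eq)
      c-proper (gh i x (inj₂ refl)) eq = spread-avoids-b (bound i) _ _ (ends-differ i) _ (sym eq)
      c-proper (hg i x (inj₁ refl)) eq = spread-avoids-a (bound i) _ _ (ends-differ i) _ eq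
      c-proper (hg i x (inj₂ refl)) eq = spread-avoids-b (bound i) _ _ (ends-differ i) _ eq

mainTheorem1 :
    (n m : ℕ) (G : SimpleGraph (Fin n)) (e : Fin m → Fin n × Fin n) →
    IsEdgeEnumeration G m e →
    (h : Fin m → ℕ) (H : (i : Fin m) → SimpleGraph (Fin (h i))) →
    (χG : ℕ) → IsChromaticNumber G χG →
    (χH : Fin m → ℕ) → ((i : Fin m) → IsChromaticNumber (H i) (χH i)) →
    IsChromaticNumber (EdgeCorona G e H) (χG ⊔ maxFin (λ i → χH i + 2))
mainTheorem1 n m G e (edges , _) h H χG χG-is χH χH-is = upper , lower
  where
    open Corona G e edges H
    M = maxFin (λ i → χH i + 2)

    upper : ProperColoring (EdgeCorona G e H) (χG ⊔ M)
    upper = corona-coloring (weaken G (m≤m⊔n χG M) (proj₁ χG-is)) χH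
              (λ i → ≤-trans (maxFin-upper (λ i → χH i + 2) i) (m≤n⊔m χG M))
              (λ i → proj₁ (χH-is i))

    lower : ∀ j → ProperColoring (EdgeCorona G e H) j → χG ⊔ M ≤ j
    lower j c = ⊔-lub (chromatic-hom-bound G-in-corona χG-is c)
                      (maxFin-least _ j (λ i → H-bound i (χH-is i) c))
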